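{- Let $G=(V,E)$ be a connected graph on $n$ nodes and let $r\ge1$ be an integer with $r\le\delta(G)$. (i) If $r\ge 2$, then $r\le \overleftarrow{MD}_r(G)\le n$. (ii) If $r=1$, then $\overleftarrow{MD}_r(G)=2$ if $G$ is bipartite and $\overleftarrow{MD}_r(G)=1$ otherwise.
   Context: $\delta(G)$ is the minimum degree of $G$; in (ii) $G$ has at least two nodes. A configuration is a map $\mathcal{C}:V\to\{b,w\}$ (black/white). In two-way $r$-bootstrap percolation, starting from $\mathcal{C}_0$, in each round $t\ge1$ all nodes update simultaneously: $\mathcal{C}_t(v)=b$ if $v$ has at least $r$ neighbors that are black in $\mathcal{C}_{t-1}$, and $\mathcal{C}_t(v)=w$ otherwise. A set $D\subseteq V$ is a dynamo if for every initial configuration in which all nodes of $D$ are black, there is a round at which all nodes of $V$ are black. $\overleftarrow{MD}_r(G)$ denotes the minimum size of a dynamo in two-way $r$-bootstrap percolation on $G$. Standing assumptions: $r\le\delta(G)$, and $r$ is fixed while $n\to\infty$. -}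

module Defs where

open import Data.Nat using (ℕ; zero; suc; _+_; _≤_; _≤ᵇ_)
open import Data.Bool using (Bool; true; false; _∧_; if_then_else_)
open import Data.Fin using (Fin; zero; suc)
open import Data.Product using (Σ; ∃; _×_; _,_)
open import Relation.Binary.PropositionalEquality using (_≡_; _≢_)
open import Relation.Binary.Construct.Closure.ReflexiveTransitive using (Star)

count : ∀ {n} → (Fin n → Bool) → ℕ
count {zero}  p = 0
count {suc n} p = (if p zero then 1 else 0) + count (λ i → p (suc i))

record Graph (n : ℕ) : Set where
  field
    adj    : Fin n → Fin n → Bool
    sym    : ∀ u v → adj u v ≡ adj v u
    irrefl : ∀ v → adj v v ≡ false
open Graph public

Adj : ∀ {n} → Graph n → Fin n → Fin n → Set
Adj G u v = adj G u v ≡ true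

degree : ∀ {n} → Graph n → Fin n → ℕ
degree G v = count (adj G v)

MinDegreeAtLeast : ∀ {n} → Graph n → ℕ → Set
MinDegreeAtLeast G r = ∀ v → r ≤ degree G v

Connected : ∀ {n} → Graph n → Set
Connected G = ∀ u v → Star (Adj G) u v

Bipartite : ∀ {n} → Graph n → Set
Bipartite {n} G = Σ (Fin n → Bool) λ c → ∀ u v → Adj G u v → c u ≢ c v

-- Configurations: true = black, false = white.
Config : ℕ → Set
Config n = Fin n → Bool

step : ∀ {n} → Graph n → ℕ → Config n → Config n
step G r C v = r ≤ᵇ count (λ u → adj G v u ∧ C u)

run : ∀ {n} → Graph n → ℕ → ℕ → Config n → Config n
run G r zero    C = C
run G r (suc t) C = step G r (run G r t C)

NodeSet : ℕ → Set
NodeSet n = Fin n → Bool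

size : ∀ {n} → NodeSet n → ℕ
size D = count D

IsDynamo : ∀ {n} → Graph n → ℕ → NodeSet n → Set
IsDynamo {n} G r D =
  (C₀ : Config n) → (∀ v → D v ≡ true → C₀ v ≡ true) →
  ∃ λ t → ∀ v → run G r t C₀ v ≡ true

IsMinDynamoSize : ∀ {n} → Graph n → ℕ → ℕ → Set
IsMinDynamoSize {n} G r k =
  (Σ (NodeSet n) λ D → IsDynamo G r D × size D ≡ k) ×
  (∀ D → IsDynamo G r D → k ≤ size D)

{-# OPTIONS --safe #-}
-- (i) By monotonicity a set D is a dynamo iff the run started from D itself turns all black,
-- and since that run repeats a configuration within 2^n rounds while all-black is absorbing
-- (δ(G) ≥ r), this happens iff round 2^n is all black. So being a dynamo is decidable and a
-- least dynamo size exists; the whole node set bounds it by n. If |D| < r, every node sees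
-- fewer than r black neighbours, so one round makes everything white, and white stays white:
-- dynamos have at least r nodes.
--
-- (ii) For r = 1 every node has a neighbour, so a black node is black again two rounds later
-- and the black sets at even rounds grow until they settle at some E with step (step E) = E.
-- Black then alternates between E and step E along every edge: if they share a node, black
-- spreads to everything, and otherwise E properly 2-colours G. Hence one node is a dynamo of
-- a non-bipartite graph and the two ends of an edge a dynamo of any graph. In a bipartite
-- graph the black nodes spawned by a single black node always lie in one colour class, so
-- no dynamo has fewer than two nodes.

module Submission where

open import Defs hiding (sym)
open import Data.Bool.Base using (Bool; true; false; not; if_then_else_; _∧_; _∨_)
open import Data.Bool.Properties using (T-≡; ¬-not; ∧-identityʳ; ∨-zeroʳ)
import Data.Bool.Properties as Bool
open import Data.Fin.Base using (Fin; zero; suc; toℕ; fromℕ<; funToFin; finToFun)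
open import Data.Fin.Properties using (_≟_; pigeonhole; toℕ<n; 2↔Bool; finToFun-funToFin; any?; all?)
open import Data.Fin.Subset.Properties using (anySubset?)
open import Data.Nat.Base using (ℕ; zero; suc; _+_; _*_; _∸_; _^_; _≤_; _<_; _≤ᵇ_; z≤n; s≤s)
open import Data.Nat.Properties hiding (_≟_)
import Data.Nat.Properties as ℕ
open import Data.Nat.Induction using (<-rec)
open import Data.Product using (Σ; ∃; ∃₂; _×_; _,_; proj₁)
open import Data.Sum using (_⊎_; inj₁; inj₂)
open import Data.Vec.Base using (lookup; tabulate)
open import Data.Vec.Properties using (lookup∘tabulate)
open import Function.Base using (_∘_)
open import Function.Bundles using (Inverse; Equivalence)
open import Relation.Binary.Construct.Closure.ReflexiveTransitive using (Star; ε; _◅_)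
open import Relation.Binary.Definitions using (_Respects_)
open import Relation.Binary.PropositionalEquality
open import Relation.Nullary using (¬_; Dec; does; yes; no; contradiction)
open import Relation.Nullary.Decidable using (map′; _×-dec_; dec-true)

infix  4 _⊆_
infixr 6 _∪_
infixr 7 _∩_

_⊆_ : ∀ {n} → NodeSet n → NodeSet n → Set
X ⊆ Y = ∀ v → X v ≡ true → Y v ≡ true

AllBlack : ∀ {n} → Config n → Set
AllBlack C = ∀ v → C v ≡ true

⁅_⁆ : ∀ {n} → Fin n → NodeSet n
⁅ u ⁆ v = does (v ≟ u)

_∪_ : ∀ {n} → NodeSet n → NodeSet n → NodeSet n
(X ∪ Y) v = X v ∨ Y v

_∩_ : ∀ {n} → NodeSet n → NodeSet n → NodeSet n
(X ∩ Y) v = X v ∧ Y v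

⁅⁆-member : ∀ {n} (u : Fin n) → ⁅ u ⁆ u ≡ true
⁅⁆-member u = dec-true (u ≟ u) refl

⁅⁆-⊆ : ∀ {n} {X : NodeSet n} {u} → X u ≡ true → ⁅ u ⁆ ⊆ X
⁅⁆-⊆ {u = u} u∈X v with v ≟ u
... | yes refl = λ _ → u∈X
... | no  _    = λ ()

∪-⊆ : ∀ {n} {X : NodeSet n} {u w} → X u ≡ true → X w ≡ true → ⁅ u ⁆ ∪ ⁅ w ⁆ ⊆ X
∪-⊆ {u = u} {w} u∈X w∈X v with v ≟ u | v ≟ w
... | yes refl | _        = λ _ → u∈X
... | no  _    | yes refl = λ _ → w∈X
... | no  _    | no  _    = λ ()

count-cong : ∀ {n} {p q : Fin n → Bool} → p ≗ q → count p ≡ count q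
count-cong {zero}  p≗q = refl
count-cong {suc n} p≗q =
  cong₂ _+_ (cong (λ b → if b then 1 else 0) (p≗q zero)) (count-cong (p≗q ∘ suc))

count-mono : ∀ {n} {p q : Fin n → Bool} → p ⊆ q → count p ≤ count q
count-mono {zero}          p⊆q = z≤n
count-mono {suc n} {p} {q} p⊆q with p zero in p₀ | q zero in q₀
... | true  | true  = s≤s (count-mono (p⊆q ∘ suc))
... | false | true  = m≤n⇒m≤1+n (count-mono (p⊆q ∘ suc))
... | false | false = count-mono (p⊆q ∘ suc)
... | true  | false = contradiction (trans (sym q₀) (p⊆q zero p₀)) λ ()

count≤n : ∀ {n} (p : Fin n → Bool) → count p ≤ n
count≤n {zero}  p = z≤n
count≤n {suc n} p with p zero
... | true  = s≤s (count≤n (p ∘ suc))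
... | false = m≤n⇒m≤1+n (count≤n (p ∘ suc))

count-full : ∀ {n} {p : Fin n → Bool} → (∀ v → p v ≡ true) → count p ≡ n
count-full {zero}  all = refl
count-full {suc n} all rewrite all zero = cong suc (count-full (all ∘ suc))

count-empty : ∀ {n} {p : Fin n → Bool} → (∀ v → p v ≡ false) → count p ≡ 0
count-empty {zero}  none = refl
count-empty {suc n} none rewrite none zero = count-empty (none ∘ suc)

⊆∧count≥⇒⊇ : ∀ {n} {p q : Fin n → Bool} → p ⊆ q → count q ≤ count p → q ⊆ p
⊆∧count≥⇒⊇ {zero} _ _ ()
⊆∧count≥⇒⊇ {suc n} {p} {q} p⊆q q≤p with p zero in p₀ | q zero in q₀
... | true  | true  = λ where
  zero    _ → p₀
  (suc v) → ⊆∧count≥⇒⊇ (p⊆q ∘ suc) (≤-pred q≤p) v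
... | false | false = λ where
  zero    q0 → contradiction (trans (sym q₀) q0) λ ()
  (suc v) → ⊆∧count≥⇒⊇ (p⊆q ∘ suc) q≤p v
... | false | true  = contradiction q≤p (<⇒≱ (s≤s (count-mono (p⊆q ∘ suc))))
... | true  | false = contradiction (trans (sym q₀) (p⊆q zero p₀)) λ ()

count-∪-∩ : ∀ {n} (p q : NodeSet n) → count (p ∪ q) + count (p ∩ q) ≡ count p + count q
count-∪-∩ {zero}  p q = refl
count-∪-∩ {suc n} p q with p zero | q zero | count-∪-∩ (p ∘ suc) (q ∘ suc)
... | true  | true  | ih = cong suc (trans (+-suc _ _) (trans (cong suc ih) (sym (+-suc _ _))))
... | true  | false | ih = cong suc ih
... | false | true  | ih = trans (cong suc ih) (sym (+-suc _ _))
... | false | false | ih = ih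

size-⁅⁆ : ∀ {n} (u : Fin n) → size ⁅ u ⁆ ≡ 1
size-⁅⁆ {suc n} zero    = cong suc (count-empty {n} {⁅ zero ⁆ ∘ suc} λ _ → refl)
size-⁅⁆         (suc u) = size-⁅⁆ u

size-⁅⁆∪⁅⁆ : ∀ {n} {u w : Fin n} → u ≢ w → size (⁅ u ⁆ ∪ ⁅ w ⁆) ≡ 2
size-⁅⁆∪⁅⁆ {u = u} {w} u≢w = begin
  size (⁅ u ⁆ ∪ ⁅ w ⁆)                          ≡⟨ +-identityʳ _ ⟨
  size (⁅ u ⁆ ∪ ⁅ w ⁆) + 0                      ≡⟨ cong (size (⁅ u ⁆ ∪ ⁅ w ⁆) +_) (count-empty disjoint) ⟨
  size (⁅ u ⁆ ∪ ⁅ w ⁆) + size (⁅ u ⁆ ∩ ⁅ w ⁆)   ≡⟨ count-∪-∩ ⁅ u ⁆ ⁅ w ⁆ ⟩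
  size ⁅ u ⁆ + size ⁅ w ⁆                       ≡⟨ cong₂ _+_ (size-⁅⁆ u) (size-⁅⁆ w) ⟩
  2                                             ∎
  where
  open ≡-Reasoning
  disjoint : ∀ v → ⁅ u ⁆ v ∧ ⁅ w ⁆ v ≡ false
  disjoint v with v ≟ u | v ≟ w
  ... | no _     | _        = refl
  ... | yes refl | no _     = refl
  ... | yes refl | yes refl = contradiction refl u≢w

member⇒1≤count : ∀ {n} {p : Fin n → Bool} {u} → p u ≡ true → 1 ≤ count p
member⇒1≤count {p = p} {u} u∈p = subst (_≤ count p) (size-⁅⁆ u) (count-mono (⁅⁆-⊆ {X = p} u∈p))

1≤count⇒member : ∀ {n} {p : Fin n → Bool} → 1 ≤ count p → ∃ λ u → p u ≡ true
1≤count⇒member {p = p} 1≤c with any? (λ v → p v Bool.≟ true)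
... | yes member = member
... | no  none   = contradiction (subst (1 ≤_) (count-empty {p = p} empty) 1≤c) λ ()
  where
  empty : ∀ v → p v ≡ false
  empty v = ¬-not (λ pv → none (v , pv))

count<2⇒unique : ∀ {n} {p : Fin n → Bool} {u w} → count p < 2 → p u ≡ true → p w ≡ true → u ≡ w
count<2⇒unique {p = p} {u} {w} c<2 u∈p w∈p with u ≟ w
... | yes u≡w = u≡w
... | no  u≢w = contradiction (subst (_≤ count p) (size-⁅⁆∪⁅⁆ u≢w) (count-mono (∪-⊆ {X = p} u∈p w∈p)))
                            (<⇒≱ c<2)

⊆-chain-stabilises : ∀ {n} (X : ℕ → NodeSet n) → (∀ k → X k ⊆ X (suc k)) → ∃ λ k → X (suc k) ⊆ X k
⊆-chain-stabilises {n} X grows with stops-or-grows (suc n)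
  where
  stops-or-grows : ∀ k → (∃ λ j → X (suc j) ⊆ X j) ⊎ k ≤ count (X k)
  stops-or-grows zero = inj₂ z≤n
  stops-or-grows (suc k) with stops-or-grows k
  ... | inj₁ stop = inj₁ stop
  ... | inj₂ k≤|Xk| with count (X (suc k)) ≤? count (X k)
  ...   | yes ≤ = inj₁ (k , ⊆∧count≥⇒⊇ (grows k) ≤)
  ...   | no  ≰ = inj₂ (≤-trans (s≤s k≤|Xk|) (≰⇒> ≰))
... | inj₁ stop = stop
... | inj₂ n<|X| = contradiction (count≤n (X (suc n))) (<⇒≱ n<|X|)

least-witness : ∀ {P : ℕ → Set} → (∀ k → Dec (P k)) → ∀ {m} → P m → ∃ λ k → P k × (∀ j → P j → k ≤ j)
least-witness     P? {zero}  p = 0 , p , λ _ _ → z≤n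
least-witness {P} P? {suc m} p with P? 0
... | yes p₀ = 0 , p₀ , λ _ _ → z≤n
... | no ¬p₀ with least-witness {P ∘ suc} (P? ∘ suc) p
...   | k , pk , least = suc k , pk , least′
  where
  least′ : ∀ j → P j → suc k ≤ j
  least′ zero    p₀ = contradiction p₀ ¬p₀
  least′ (suc j) pj = s≤s (least j pj)

Star-respects : ∀ {A : Set} {R : A → A → Set} {P : A → Set} → P Respects R → P Respects Star R
Star-respects resp ε              p = p
Star-respects resp (xRy ◅ yR⋆z) p = Star-respects resp yR⋆z (resp xRy p)

encode : ∀ {n} → Config n → Fin (2 ^ n)
encode C = funToFin (Inverse.from 2↔Bool ∘ C)

encode-injective : ∀ {n} (C C′ : Config n) → encode C ≡ encode C′ → C ≗ C′
encode-injective C C′ eq v = begin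
  C v                             ≡⟨ Inverse.strictlyInverseˡ 2↔Bool (C v) ⟨
  to (from (C v))                 ≡⟨ cong to (finToFun-funToFin (from ∘ C) v) ⟨
  to (finToFun (encode C) v)      ≡⟨ cong (λ k → to (finToFun k v)) eq ⟩
  to (finToFun (encode C′) v)     ≡⟨ cong to (finToFun-funToFin (from ∘ C′) v) ⟩
  to (from (C′ v))                ≡⟨ Inverse.strictlyInverseˡ 2↔Bool (C′ v) ⟩
  C′ v                            ∎
  where
  open ≡-Reasoning
  open Inverse 2↔Bool using (to; from)

module Percolation {n} (G : Graph n) (r : ℕ) where

  blackNeighbours : Config n → Fin n → NodeSet n
  blackNeighbours C v u = adj G v u ∧ C u

  threshold⇒black : ∀ {C v} → r ≤ count (blackNeighbours C v) → step G r C v ≡ true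
  threshold⇒black r≤ = Equivalence.to T-≡ (≤⇒≤ᵇ r≤)

  black⇒threshold : ∀ {C v} → step G r C v ≡ true → r ≤ count (blackNeighbours C v)
  black⇒threshold black = ≤ᵇ⇒≤ r _ (Equivalence.from T-≡ black)

  step-cong : ∀ {C C′} → C ≗ C′ → step G r C ≗ step G r C′
  step-cong C≗C′ v = cong (r ≤ᵇ_) (count-cong (λ u → cong (adj G v u ∧_) (C≗C′ u)))

  run-cong : ∀ t {C C′} → C ≗ C′ → run G r t C ≗ run G r t C′
  run-cong zero    C≗C′ = C≗C′
  run-cong (suc t) C≗C′ = step-cong (run-cong t C≗C′)

  step-mono : ∀ {C C′} → C ⊆ C′ → step G r C ⊆ step G r C′
  step-mono {C} {C′} C⊆C′ v black =
    threshold⇒black (≤-trans (black⇒threshold black) (count-mono neighbours⊆))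
    where
    neighbours⊆ : blackNeighbours C v ⊆ blackNeighbours C′ v
    neighbours⊆ u with adj G v u
    ... | true = C⊆C′ u

  run-mono : ∀ t {C C′} → C ⊆ C′ → run G r t C ⊆ run G r t C′
  run-mono zero    C⊆C′ = C⊆C′
  run-mono (suc t) C⊆C′ = step-mono (run-mono t C⊆C′)

  run-+ : ∀ s t C → run G r (s + t) C ≡ run G r s (run G r t C)
  run-+ zero    t C = refl
  run-+ (suc s) t C = cong (step G r) (run-+ s t C)

  run-shift : ∀ {i j C} → run G r i C ≗ run G r j C → ∀ k → run G r (k + i) C ≗ run G r (k + j) C
  run-shift {i} {j} {C} rep k v = begin
    run G r (k + i) C v         ≡⟨ cong-app (run-+ k i C) v ⟩
    run G r k (run G r i C) v   ≡⟨ run-cong k rep v ⟩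
    run G r k (run G r j C) v   ≡⟨ cong-app (run-+ k j C) v ⟨
    run G r (k + j) C v         ∎
    where open ≡-Reasoning

  run-repeats : ∀ C → ∃₂ λ i j → i < j × j ≤ 2 ^ n × run G r i C ≗ run G r j C
  run-repeats C with i , j , i<j , eq ← pigeonhole (n<1+n (2 ^ n)) (λ k → encode (run G r (toℕ k) C))
    = toℕ i , toℕ j , i<j , ≤-pred (toℕ<n j) , encode-injective _ _ eq

  black⇒threshold≤count : ∀ {C v} → step G r C v ≡ true → r ≤ count C
  black⇒threshold≤count {C} {v} black = ≤-trans (black⇒threshold black) (count-mono neighbours⊆C)
    where
    neighbours⊆C : blackNeighbours C v ⊆ C
    neighbours⊆C u with adj G v u
    ... | true = λ black-u → black-u

  run-sparse : 1 ≤ r → ∀ {C} → count C < r → ∀ t → count (run G r t C) < r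
  run-sparse 1≤r sparse zero    = sparse
  run-sparse 1≤r sparse (suc t) = subst (_< r) (sym (count-empty white)) 1≤r
    where
    white : ∀ v → step G r (run G r t _) v ≡ false
    white v = ¬-not (λ black → <⇒≱ (run-sparse 1≤r sparse t) (black⇒threshold≤count black))

  DynamoOfSize : ℕ → Set
  DynamoOfSize k = Σ (NodeSet n) λ D → IsDynamo G r D × size D ≡ k

  isDynamo-cong : ∀ {D D′} → D ≗ D′ → IsDynamo G r D → IsDynamo G r D′
  isDynamo-cong D≗D′ dynamo C₀ D′⊆C₀ = dynamo C₀ (λ v D∋v → D′⊆C₀ v (trans (sym (D≗D′ v)) D∋v))

  whole-dynamo : DynamoOfSize n
  whole-dynamo = (λ _ → true) , (λ C₀ V⊆C₀ → 0 , λ v → V⊆C₀ v refl) , count-full (λ _ → refl)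

  dynamo-size≥r : 1 ≤ r → r ≤ n → ∀ {D} → IsDynamo G r D → r ≤ size D
  dynamo-size≥r 1≤r r≤n {D} dynamo with r ≤? size D
  ... | yes r≤|D| = r≤|D|
  ... | no  r≰|D| with t , black ← dynamo D (λ _ D∋v → D∋v)
    = contradiction r≤n (<⇒≱ (subst (_< r) (count-full black) (run-sparse 1≤r (≰⇒> r≰|D|) t)))

  module _ (minDegree : MinDegreeAtLeast G r) where

    step-allBlack : ∀ {C} → AllBlack C → AllBlack (step G r C)
    step-allBlack {C} black v = threshold⇒black (subst (r ≤_) (count-cong neighbours≡) (minDegree v))
      where
      neighbours≡ : adj G v ≗ blackNeighbours C v
      neighbours≡ u = trans (sym (∧-identityʳ (adj G v u))) (cong (adj G v u ∧_) (sym (black u)))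

    allBlack-later : ∀ {C s t} → s ≤ t → AllBlack (run G r s C) → AllBlack (run G r t C)
    allBlack-later {C} {s} {t} s≤t black = subst (AllBlack ∘ λ k → run G r k C) (m∸n+n≡m s≤t)
      (subst AllBlack (sym (run-+ (t ∸ s) s C)) (stays (t ∸ s)))
      where
      stays : ∀ k → AllBlack (run G r k (run G r s C))
      stays zero    = black
      stays (suc k) = step-allBlack (stays k)

    -- The run repeats a configuration within 2^n rounds, so a later all-black round can be
    -- moved back by the length of the cycle.
    allBlack-by-2^n : ∀ C t → AllBlack (run G r t C) → AllBlack (run G r (2 ^ n) C)
    allBlack-by-2^n C = <-rec (λ t → AllBlack (run G r t C) → AllBlack (run G r (2 ^ n) C)) shorten
      where
      shorten : ∀ t → (∀ {s} → s < t → AllBlack (run G r s C) → AllBlack (run G r (2 ^ n) C))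
              → AllBlack (run G r t C) → AllBlack (run G r (2 ^ n) C)
      shorten t earlier black with t ≤? 2 ^ n
      ... | yes t≤2^n = allBlack-later t≤2^n black
      ... | no  t≰2^n with i , j , i<j , j≤2^n , rep ← run-repeats C = earlier shorter black′
        where
        j≤t : j ≤ t
        j≤t = ≤-trans j≤2^n (<⇒≤ (≰⇒> t≰2^n))
        t≡ : t ∸ j + j ≡ t
        t≡ = m∸n+n≡m j≤t
        shorter : t ∸ j + i < t
        shorter = subst (t ∸ j + i <_) t≡ (+-monoʳ-< (t ∸ j) i<j)
        black′ : AllBlack (run G r (t ∸ j + i) C)
        black′ v = trans (run-shift rep (t ∸ j) v) (subst (λ k → run G r k C v ≡ true) (sym t≡) (black v))

    isDynamo? : ∀ D → Dec (IsDynamo G r D)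
    isDynamo? D = map′ sufficient necessary (all? (λ v → run G r (2 ^ n) D v Bool.≟ true))
      where
      sufficient : AllBlack (run G r (2 ^ n) D) → IsDynamo G r D
      sufficient black C₀ D⊆C₀ = 2 ^ n , λ v → run-mono (2 ^ n) D⊆C₀ v (black v)
      necessary : IsDynamo G r D → AllBlack (run G r (2 ^ n) D)
      necessary dynamo with t , black ← dynamo D (λ _ D∋v → D∋v) = allBlack-by-2^n D t black

    dynamo-of-size? : ∀ k → Dec (DynamoOfSize k)
    dynamo-of-size? k = map′ toNodeSet fromNodeSet
      (anySubset? (λ S → isDynamo? (lookup S) ×-dec (size (lookup S) ℕ.≟ k)))
      where
      toNodeSet : (∃ λ S → IsDynamo G r (lookup S) × size (lookup S) ≡ k) → DynamoOfSize k
      toNodeSet (S , dynamo , |S|) = lookup S , dynamo , |S|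
      fromNodeSet : DynamoOfSize k → ∃ λ S → IsDynamo G r (lookup S) × size (lookup S) ≡ k
      fromNodeSet (D , dynamo , |D|) =
        tabulate D , isDynamo-cong (sym ∘ lookup∘tabulate D) dynamo , trans (count-cong (lookup∘tabulate D)) |D|

    threshold≤order : 1 ≤ n → r ≤ n
    threshold≤order 1≤n = ≤-trans (minDegree (fromℕ< 1≤n)) (count≤n _)

    min-dynamo-size : 1 ≤ n → 1 ≤ r → ∃ λ k → IsMinDynamoSize G r k × r ≤ k × k ≤ n
    min-dynamo-size 1≤n 1≤r with k , (D , dynamo , |D|≡k) , least ← least-witness dynamo-of-size? whole-dynamo
      = k , ((D , dynamo , |D|≡k) , λ D′ dynamo′ → least (size D′) (D′ , dynamo′ , refl))
          , subst (r ≤_) |D|≡k (dynamo-size≥r 1≤r (threshold≤order 1≤n) dynamo)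
          , least n whole-dynamo

module ThresholdOne {n} (G : Graph n) (minDegree : MinDegreeAtLeast G 1) where
  open Percolation G 1

  ProperColouring : (Fin n → Bool) → Set
  ProperColouring c = ∀ u w → Adj G u w → c u ≢ c w

  Monochromatic : (Fin n → Bool) → NodeSet n → Set
  Monochromatic c X = ∀ {x y} → X x ≡ true → X y ≡ true → c x ≡ c y

  Adj-sym : ∀ {u w} → Adj G u w → Adj G w u
  Adj-sym {u} {w} u~w = trans (Graph.sym G w u) u~w

  Adj-irrefl : ∀ {u w} → Adj G u w → u ≢ w
  Adj-irrefl {u} u~u refl = contradiction (trans (sym u~u) (irrefl G u)) λ ()

  neighbour : ∀ v → ∃ λ u → Adj G v u
  neighbour v = 1≤count⇒member (minDegree v)

  black-neighbour⇒black : ∀ {C v u} → Adj G v u → C u ≡ true → step G 1 C v ≡ true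
  black-neighbour⇒black {C} {v} v~u black =
    threshold⇒black (member⇒1≤count {p = blackNeighbours C v} (cong₂ _∧_ v~u black))

  black⇒black-neighbour : ∀ {C v} → step G 1 C v ≡ true → ∃ λ u → Adj G v u × C u ≡ true
  black⇒black-neighbour black with u , both ← 1≤count⇒member (black⇒threshold black) = u , ∧-true both
    where
    ∧-true : ∀ {a b} → a ∧ b ≡ true → a ≡ true × b ≡ true
    ∧-true {true} refl = refl , refl

  ⊆-step² : ∀ C → C ⊆ step G 1 (step G 1 C)
  ⊆-step² C v black with u , v~u ← neighbour v =
    black-neighbour⇒black v~u (black-neighbour⇒black (Adj-sym v~u) black)

  run-2*suc : ∀ k C → run G 1 (2 * suc k) C ≡ step G 1 (step G 1 (run G 1 (2 * k) C))
  run-2*suc k C = cong (λ t → run G 1 t C) (*-suc 2 k)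

  run-2*-grows : ∀ C k → run G 1 (2 * k) C ⊆ run G 1 (2 * suc k) C
  run-2*-grows C k = subst (run G 1 (2 * k) C ⊆_) (sym (run-2*suc k C)) (⊆-step² _)

  ⊆-run-2* : ∀ C k → C ⊆ run G 1 (2 * k) C
  ⊆-run-2* C zero    v black = black
  ⊆-run-2* C (suc k) v black = run-2*-grows C k v (⊆-run-2* C k v black)

  settles : ∀ C → ∃ λ t → C ⊆ run G 1 t C × step G 1 (step G 1 (run G 1 t C)) ⊆ run G 1 t C
  settles C with k , stable ← ⊆-chain-stabilises (λ k → run G 1 (2 * k) C) (run-2*-grows C)
    = 2 * k , ⊆-run-2* C k , subst (_⊆ run G 1 (2 * k) C) (run-2*suc k C) stable

  module Settled (connected : Connected G) {E : Config n} (settled : step G 1 (step G 1 E) ⊆ E) where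

    E⇒stepE : ∀ {u w} → Adj G u w → E u ≡ true → step G 1 E w ≡ true
    E⇒stepE u~w = black-neighbour⇒black (Adj-sym u~w)

    stepE⇒E : ∀ {u w} → Adj G u w → step G 1 E u ≡ true → E w ≡ true
    stepE⇒E u~w = settled _ ∘ black-neighbour⇒black (Adj-sym u~w)

    meet⇒allBlack : ∀ {x} → E x ≡ true → step G 1 E x ≡ true → AllBlack E
    meet⇒allBlack {x} Ex stepEx y = proj₁ (Star-respects spread (connected x y) (Ex , stepEx))
      where
      spread : (λ z → E z ≡ true × step G 1 E z ≡ true) Respects Adj G
      spread z~w (Ez , stepEz) = stepE⇒E z~w stepEz , E⇒stepE z~w Ez

    apart⇒bipartite : ∀ {x} → E x ≡ true →
      ¬ (∃ λ y → E y ≡ true × step G 1 E y ≡ true) → Bipartite G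
    apart⇒bipartite {x} Ex apart = E , properly-coloured
      where
      spread : (λ z → E z ≡ true ⊎ step G 1 E z ≡ true) Respects Adj G
      spread z~w (inj₁ Ez)     = inj₂ (E⇒stepE z~w Ez)
      spread z~w (inj₂ stepEz) = inj₁ (stepE⇒E z~w stepEz)
      properly-coloured : ProperColouring E
      properly-coloured u w u~w Eu≡Ew with Star-respects spread (connected x u) (inj₁ Ex)
      ... | inj₁ Eu     = apart (w , trans (sym Eu≡Ew) Eu , E⇒stepE u~w Eu)
      ... | inj₂ stepEu = apart (u , trans Eu≡Ew (stepE⇒E u~w stepEu) , stepEu)

  module _ (connected : Connected G) where
    open Settled connected

    allBlack-or-bipartite : ∀ {C v} → C v ≡ true → (∃ λ t → AllBlack (run G 1 t C)) ⊎ Bipartite G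
    allBlack-or-bipartite {C} {v} Cv with t , C⊆E , settled ← settles C
      with any? (λ x → (run G 1 t C x Bool.≟ true) ×-dec (step G 1 (run G 1 t C) x Bool.≟ true))
    ... | yes (x , Ex , stepEx) = inj₁ (t , meet⇒allBlack settled Ex stepEx)
    ... | no  apart             = inj₂ (apart⇒bipartite settled (C⊆E v Cv) apart)

    edge⇒allBlack : ∀ {C u w} → Adj G u w → C u ≡ true → C w ≡ true →
      ∃ λ t → AllBlack (run G 1 t C)
    edge⇒allBlack {C} u~w Cu Cw with t , C⊆E , settled ← settles C =
      t , meet⇒allBlack settled (C⊆E _ Cu) (black-neighbour⇒black u~w (C⊆E _ Cw))

    ⁅⁆-dynamo : ¬ Bipartite G → ∀ v → IsDynamo G 1 ⁅ v ⁆
    ⁅⁆-dynamo ¬bipartite v C₀ v∈C₀ with allBlack-or-bipartite (v∈C₀ v (⁅⁆-member v))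
    ... | inj₁ allBlack  = allBlack
    ... | inj₂ bipartite = contradiction bipartite ¬bipartite

    edge-dynamo : ∀ {u w} → Adj G u w → IsDynamo G 1 (⁅ u ⁆ ∪ ⁅ w ⁆)
    edge-dynamo {u} {w} u~w C₀ edge⊆C₀ = edge⇒allBlack u~w
      (edge⊆C₀ u (cong (_∨ ⁅ w ⁆ u) (⁅⁆-member u)))
      (edge⊆C₀ w (trans (cong (⁅ u ⁆ w ∨_) (⁅⁆-member w)) (∨-zeroʳ _)))

  step-monochromatic : ∀ {c} → ProperColouring c →
    ∀ {X} → Monochromatic c X → Monochromatic c (step G 1 X)
  step-monochromatic {c} proper mono {x} {y} stepXx stepXy
    with x′ , x~x′ , Xx′ ← black⇒black-neighbour stepXx
       | y′ , y~y′ , Xy′ ← black⇒black-neighbour stepXy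
    = begin
      c x         ≡⟨ ¬-not (proper x x′ x~x′) ⟩
      not (c x′)  ≡⟨ cong not (mono Xx′ Xy′) ⟩
      not (c y′)  ≡⟨ ¬-not (proper y y′ y~y′) ⟨
      c y         ∎
    where open ≡-Reasoning

  dynamo-size≥2 : 1 ≤ n → Bipartite G → ∀ {D} → IsDynamo G 1 D → 2 ≤ size D
  dynamo-size≥2 1≤n (c , proper) {D} dynamo with 2 ≤? size D
  ... | yes 2≤|D| = 2≤|D|
  ... | no  2≰|D|
    with t , black ← dynamo D (λ _ D∋v → D∋v)
       | w , u~w ← neighbour (fromℕ< 1≤n)
    = contradiction (monochromatic t (black _) (black w)) (proper _ w u~w)
    where
    monochromatic : ∀ t → Monochromatic c (run G 1 t D)
    monochromatic zero    Dx Dy = cong c (count<2⇒unique (≰⇒> 2≰|D|) Dx Dy)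
    monochromatic (suc t) = step-monochromatic proper (monochromatic t)

  threshold-one : 1 ≤ n → Connected G →
    (Bipartite G → IsMinDynamoSize G 1 2) × (¬ Bipartite G → IsMinDynamoSize G 1 1)
  threshold-one 1≤n connected with u ← fromℕ< 1≤n | w , u~w ← neighbour (fromℕ< 1≤n) =
      (λ bipartite → (⁅ u ⁆ ∪ ⁅ w ⁆ , edge-dynamo connected u~w , size-⁅⁆∪⁅⁆ (Adj-irrefl u~w))
                   , λ _ → dynamo-size≥2 1≤n bipartite)
    , (λ ¬bipartite → (⁅ u ⁆ , ⁅⁆-dynamo connected ¬bipartite u , size-⁅⁆ u)
                    , λ _ → dynamo-size≥r ≤-refl (threshold≤order minDegree 1≤n))

-- Part (i) holds for every r ≥ 1, and 2 ≤ n follows from δ(G) ≥ 1.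
theorem4 : ∀ {n} (G : Graph n) (r : ℕ) → 1 ≤ n → Connected G → 1 ≤ r → MinDegreeAtLeast G r →
    (2 ≤ r → ∃ λ k → IsMinDynamoSize G r k × r ≤ k × k ≤ n) ×
    (r ≡ 1 → 2 ≤ n → (Bipartite G → IsMinDynamoSize G r 2) × (¬ Bipartite G → IsMinDynamoSize G r 1))
theorem4 G r 1≤n connected 1≤r minDegree =
    (λ _ → Percolation.min-dynamo-size G r minDegree 1≤n 1≤r)
  , λ { refl _ → ThresholdOne.threshold-one G minDegree 1≤n connected }
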